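{- For every undirected, simple temporal graph $\mathcal{G}=(V,E,\lambda)$, considered with non-strict temporal paths, there exists a simple and proper directed temporal graph $\mathcal{H}$ on the same vertex set $V$ with $\mathcal{R}(\mathcal{G})=\mathcal{R}(\mathcal{H})$. In other words, every graph in the setting UD \& non-strict \& simple has a reachability equivalent graph in the setting D \& proper \& simple.
   Context: A directed (resp. undirected) temporal graph is a triple $(V,E,\lambda)$ with $V$ finite, $E$ a set of arcs $(u,v)$, $u\ne v$ (resp. 2-element subsets of $V$), and $\lambda$ assigning each arc/edge a nonempty finite set of time labels; it is simple if every edge has exactly one label, and proper if no two distinct edges incident to a common vertex share a label. A temporal path from $u$ to $v$ is a sequence $(e_1,t_1),\dots,(e_k,t_k)$, $k\ge1$, $t_i\in\lambda(e_i)$, with $e_1,\dots,e_k$ a path from $u$ to $v$ in the footprint (distinct vertices, respecting arc directions in the directed case) and $t_1\le\dots\le t_k$ (non-strict paths; in a proper graph all such paths have strictly increasing labels). The reachability graph $\mathcal{R}(\cdot)$ is the static directed graph on $V$ with arc $(u,v)$, $u\ne v$, iff there is a temporal path from $u$ to $v$. -}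

module Defs where

open import Data.Nat using (ℕ; zero; suc; _≤_)
open import Data.Fin as F using (Fin; zero; suc; fromℕ; inject₁)
open import Data.Maybe using (Maybe; just; nothing)
open import Data.Product using (_×_)
open import Data.Sum using (_⊎_)
open import Relation.Binary.PropositionalEquality using (_≡_; _≢_)
open import Function.Definitions using (Injective)
open import Function.Bundles using (_⇔_)

-- A *simple* temporal graph assigns each (ordered) pair of vertices at most
-- one label: lab u v ≡ just t means (u,v) is an arc/edge with label t,
-- lab u v ≡ nothing means no arc/edge.

-- Undirected simple temporal graph: edges are 2-element subsets, so the
-- labelling is symmetric and there are no loops.
record UTGraph (n : ℕ) : Set where
  field
    lab    : Fin n → Fin n → Maybe ℕ
    sym    : ∀ u v → lab u v ≡ lab v u
    noloop : ∀ u → lab u u ≡ nothing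
open UTGraph public

record DTGraph (n : ℕ) : Set where
  field
    lab    : Fin n → Fin n → Maybe ℕ
    noloop : ∀ u → lab u u ≡ nothing
open DTGraph public

ShareVertex : ∀ {n} → Fin n → Fin n → Fin n → Fin n → Set
ShareVertex u v u' v' = u ≡ u' ⊎ u ≡ v' ⊎ v ≡ u' ⊎ v ≡ v'

Proper : ∀ {n} → DTGraph n → Set
Proper {n} H = ∀ (u v u' v' : Fin n) (t : ℕ) →
  DTGraph.lab H u v ≡ just t → DTGraph.lab H u' v' ≡ just t →
  ShareVertex u v u' v' → (u ≡ u' × v ≡ v')

-- Non-strict temporal path from u to v w.r.t. a labelling lab:
-- vertices x₀ = u, …, x_{k+1} = v pairwise distinct (k+1 ≥ 1 edges),
-- (x_i , x_{i+1}) an arc/edge with label t_i, labels non-decreasing.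
-- For an undirected graph lab is symmetric, so orientation is irrelevant.
record TemporalPath {n : ℕ} (lab : Fin n → Fin n → Maybe ℕ) (u v : Fin n) : Set where
  field
    k        : ℕ
    verts    : Fin (suc (suc k)) → Fin n
    times    : Fin (suc k) → ℕ
    start    : verts zero ≡ u
    end      : verts (fromℕ (suc k)) ≡ v
    distinct : Injective _≡_ _≡_ verts
    edges    : ∀ (i : Fin (suc k)) → lab (verts (inject₁ i)) (verts (suc i)) ≡ just (times i)
    mono     : ∀ (i j : Fin (suc k)) → i F.≤ j → times i ≤ times j

Reach : ∀ {n} → (Fin n → Fin n → Maybe ℕ) → Fin n → Fin n → Set
Reach lab u v = u ≢ v × TemporalPath lab u v

SameReach : ∀ {n} → UTGraph n → DTGraph n → Set
SameReach {n} G H = ∀ (u v : Fin n) → Reach (UTGraph.lab G) u v ⇔ Reach (DTGraph.lab H) u v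

module Submission where

-- For each label s, every connected component C of the edges of G labelled s gets a root
-- (its least vertex) and BFS depths.  The times of H come in blocks, one per label, ordered
-- like the labels.  An edge {x, p} of C with depth p < depth x becomes the arc x → p, timed
-- in the first half of the block of s and the later the closer x is to the root, and the arc
-- p → x, timed in the second half and the later the deeper p is.  So inside the block of s
-- every vertex of C climbs to the root and descends to any other vertex of C, just as a
-- non-strict path of G may wander through C at time s; conversely, as blocks are ordered
-- like labels, every temporal path of H projects onto a walk of G with non-decreasing labels.
-- Adding a code of the arc below the resolution of the blocks makes all times of H distinct,
-- so H is proper.

open import Defs hiding (sym; lab; noloop)
open import Data.Nat using (ℕ; zero; suc; _+_; _*_; _∸_; _≤_; _<_; z≤n; s≤s; _⊔_; NonZero)
open import Data.Nat.Properties
open import Data.Nat.DivMod using (_%_; [m+kn]%n≡m%n; m<n⇒m%n≡m)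
open import Data.Fin as F using (Fin; zero; suc; fromℕ; toℕ; combine)
import Data.Fin.Properties as FP
open import Data.Maybe using (Maybe; just; nothing; _>>=_)
import Data.Maybe.Properties as MP
open import Data.Product using (Σ; ∃; _×_; _,_; proj₂)
open import Data.Sum using (_⊎_; inj₁; inj₂)
open import Data.List using (List; []; _∷_)
open import Data.List.Relation.Unary.All as All using ([]; _∷_)
open import Data.List.Relation.Unary.All.Properties using (¬Any⇒All¬)
open import Data.List.Relation.Unary.AllPairs using ([]; _∷_)
open import Data.List.Relation.Unary.Any using (here; there)
open import Data.List.Relation.Unary.Unique.Propositional using (Unique)
open import Data.List.Membership.Propositional using (_∈_)
open import Relation.Nullary using (Dec; yes; no; contradiction)
open import Relation.Nullary.Decidable using (_×-dec_; _⊎-dec_)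
open import Relation.Unary using (Pred; Decidable)
open import Relation.Binary.Definitions using (tri<; tri≈; tri>)
open import Relation.Binary.Construct.Closure.ReflexiveTransitive using (Star; ε; _◅_; _◅◅_; reverse)
open import Relation.Binary.PropositionalEquality
open import Function using (_∘_)
open import Function.Bundles using (mk⇔)
open import Function.Definitions using (Injective)

record Least {n p} (P : Pred (Fin n) p) : Set p where
  field
    min     : Fin n
    holds   : P min
    minimal : ∀ {i} → P i → min F.≤ i

least : ∀ {n p} {P : Pred (Fin n) p} → Decidable P → ∃ P → Least P
least {zero} _ (() , _)
least {suc n} {P = P} P? (i , Pi) with P? zero
... | yes P0 = record { min = zero ; holds = P0 ; minimal = λ _ → z≤n }
... | no ¬P0 = record { min = suc min ; holds = holds ; minimal = minimal′ }
  where
  shift : ∀ i → P i → ∃ (P ∘ suc)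
  shift zero P0 = contradiction P0 ¬P0
  shift (suc i) Pi = i , Pi
  open Least (least (P? ∘ suc) (shift i Pi))
  minimal′ : ∀ {j} → P j → suc min F.≤ j
  minimal′ {zero} P0 = contradiction P0 ¬P0
  minimal′ {suc j} Pj = s≤s (minimal Pj)

Least-unique : ∀ {n p q} {P : Pred (Fin n) p} {Q : Pred (Fin n) q} →
               (∀ {i} → P i → Q i) → (∀ {i} → Q i → P i) →
               (a : Least P) (b : Least Q) → Least.min a ≡ Least.min b
Least-unique P⇒Q Q⇒P a b =
  FP.≤-antisym (minimal a (Q⇒P (holds b))) (minimal b (P⇒Q (holds a)))
  where open Least

m<n⇒m*o+p<n*o : ∀ {m n o p} → m < n → p < o → m * o + p < n * o
m<n⇒m*o+p<n*o {m} {n} {o} {p} m<n p<o = begin-strict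
  m * o + p  <⟨ +-monoʳ-< (m * o) p<o ⟩
  m * o + o  ≡⟨ +-comm (m * o) o ⟩
  suc m * o  ≤⟨ *-monoˡ-≤ o m<n ⟩
  n * o      ∎
  where open ≤-Reasoning

[m*o+p]%o≡p : ∀ m {o p} .{{_ : NonZero o}} → p < o → (m * o + p) % o ≡ p
[m*o+p]%o≡p m {o} {p} p<o = begin
  (m * o + p) % o  ≡⟨ cong (_% o) (+-comm (m * o) p) ⟩
  (p + m * o) % o  ≡⟨ [m+kn]%n≡m%n p m o ⟩
  p % o            ≡⟨ m<n⇒m%n≡m p<o ⟩
  p                ∎
  where open ≡-Reasoning

module TemporalWalks {n : ℕ} (lab : Fin n → Fin n → Maybe ℕ) where

  open import Data.List.Membership.DecPropositional (F._≟_ {n}) using (_∈?_)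
  open TemporalPath

  -- Unlike temporal paths, walks may be empty and may revisit vertices;
  -- the labels of a walk in  Walk L U x y  are non-decreasing and lie between L and U.
  data Walk : ℕ → ℕ → Fin n → Fin n → Set where
    stay : ∀ {L U x} → Walk L U x x
    step : ∀ {L U x w y s} →
           lab x w ≡ just s → L ≤ s → s ≤ U → Walk s U w y → Walk L U x y

  weakenˡ : ∀ {L L′ U x y} → L′ ≤ L → Walk L U x y → Walk L′ U x y
  weakenˡ _ stay = stay
  weakenˡ L′≤L (step e L≤s s≤U w) = step e (≤-trans L′≤L L≤s) s≤U w

  weakenʳ : ∀ {L U U′ x y} → U ≤ U′ → Walk L U x y → Walk L U′ x y
  weakenʳ _ stay = stay
  weakenʳ U≤U′ (step e L≤s s≤U w) =
    step e L≤s (≤-trans s≤U U≤U′) (weakenʳ U≤U′ w)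

  append : ∀ {L M U x a y} → L ≤ M → M ≤ U → Walk L M x a → Walk M U a y → Walk L U x y
  append L≤M _ stay w′ = weakenˡ L≤M w′
  append _ M≤U (step e L≤s s≤M w) w′ =
    step e L≤s (≤-trans s≤M M≤U) (append s≤M M≤U w w′)

  vertices : ∀ {L U x y} → Walk L U x y → List (Fin n)
  vertices (stay {x = x}) = x ∷ []
  vertices (step {x = x} _ _ _ w) = x ∷ vertices w

  SimpleWalk : ℕ → ℕ → Fin n → Fin n → Set
  SimpleWalk L U x y = ∃ λ (w : Walk L U x y) → Unique (vertices w)

  vertices-weakenˡ : ∀ {L L′ U x y} (L′≤L : L′ ≤ L) (w : Walk L U x y) →
                     vertices (weakenˡ L′≤L w) ≡ vertices w
  vertices-weakenˡ _ stay = refl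
  vertices-weakenˡ _ (step _ _ _ _) = refl

  weakenˡ-simple : ∀ {L L′ U x y} → L′ ≤ L → SimpleWalk L U x y → SimpleWalk L′ U x y
  weakenˡ-simple L′≤L (w , u) =
    weakenˡ L′≤L w , subst Unique (sym (vertices-weakenˡ L′≤L w)) u

  dropUntil : ∀ {L U w y} x (p : Walk L U w y) → x ∈ vertices p → Unique (vertices p) →
              SimpleWalk L U x y
  dropUntil x stay (here refl) u = stay , u
  dropUntil x p@(step _ _ _ _) (here refl) u = p , u
  dropUntil x (step _ L≤s _ w) (there x∈w) (_ ∷ u) =
    weakenˡ-simple L≤s (dropUntil x w x∈w u)

  shortcut : ∀ {L U x y} → Walk L U x y → SimpleWalk L U x y
  shortcut stay = stay , [] ∷ []
  shortcut {x = x} (step e L≤s s≤U w) with shortcut w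
  ... | w′ , u with x ∈? vertices w′
  ...   | yes x∈w′ = weakenˡ-simple L≤s (dropUntil x w′ x∈w′ u)
  ...   | no x∉w′ = step e L≤s s≤U w′ , ¬Any⇒All¬ (vertices w′) x∉w′ ∷ u

  singleEdge : ∀ {x y t} → x ≢ y → lab x y ≡ just t → TemporalPath lab x y
  singleEdge {x} {y} {t} x≢y e = record
    { k = zero ; verts = ends ; times = λ _ → t ; start = refl ; end = refl
    ; distinct = ends-injective ; edges = λ { zero → e } ; mono = λ _ _ _ → ≤-refl }
    where
    ends : Fin 2 → Fin n
    ends zero = x
    ends (suc _) = y
    ends-injective : Injective _≡_ _≡_ ends
    ends-injective {zero} {zero} _ = refl
    ends-injective {zero} {suc zero} x≡y = contradiction x≡y x≢y
    ends-injective {suc zero} {zero} y≡x = contradiction (sym y≡x) x≢y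
    ends-injective {suc zero} {suc zero} _ = refl

  prepend : ∀ {x w y s} → lab x w ≡ just s → (p : TemporalPath lab w y) →
            s ≤ times p zero → (∀ i → verts p i ≢ x) → TemporalPath lab x y
  prepend {x} {s = s} e p s≤t₀ fresh = record
    { k = suc (k p) ; verts = verts′ ; times = times′ ; start = refl ; end = end p
    ; distinct = distinct′ ; edges = edges′ ; mono = mono′ }
    where
    verts′ : Fin (suc (suc (suc (k p)))) → Fin n
    verts′ zero = x
    verts′ (suc i) = verts p i
    times′ : Fin (suc (suc (k p))) → ℕ
    times′ zero = s
    times′ (suc i) = times p i
    distinct′ : Injective _≡_ _≡_ verts′
    distinct′ {zero} {zero} _ = refl
    distinct′ {zero} {suc j} x≡ = contradiction (sym x≡) (fresh j)
    distinct′ {suc i} {zero} ≡x = contradiction ≡x (fresh i)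
    distinct′ {suc i} {suc j} eq = cong suc (distinct p eq)
    edges′ : ∀ i → lab (verts′ (F.inject₁ i)) (verts′ (suc i)) ≡ just (times′ i)
    edges′ zero = subst (λ v → lab x v ≡ just s) (sym (start p)) e
    edges′ (suc i) = edges p i
    mono′ : ∀ i j → i F.≤ j → times′ i ≤ times′ j
    mono′ zero zero _ = ≤-refl
    mono′ zero (suc j) _ = ≤-trans s≤t₀ (mono p zero j z≤n)
    mono′ (suc i) (suc j) (s≤s i≤j) = mono p i j i≤j

  record PathWithin (s : ℕ) (vs : List (Fin n)) (x y : Fin n) : Set where
    field
      path   : TemporalPath lab x y
      starts : s ≤ times path zero
      inside : ∀ i → verts path i ∈ vs

  simpleWalk⇒path : ∀ {x w y s U} → lab x w ≡ just s → (r : Walk s U w y) →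
                    Unique (x ∷ vertices r) → PathWithin s (x ∷ vertices r) x y
  simpleWalk⇒path e stay ((x≢y ∷ []) ∷ _) = record
    { path = singleEdge x≢y e ; starts = ≤-refl
    ; inside = λ { zero → here refl ; (suc zero) → there (here refl) } }
  simpleWalk⇒path {x} {w} {y} e (step e′ s≤s′ _ r) (x∉r ∷ u) = record
    { path = path′ ; starts = ≤-refl ; inside = inside′ }
    where
    open PathWithin (simpleWalk⇒path e′ r u)
    fresh : ∀ i → verts path i ≢ x
    fresh i eq = All.lookup x∉r (inside i) (sym eq)
    path′ : TemporalPath lab x y
    path′ = prepend e path (≤-trans s≤s′ starts) fresh
    inside′ : ∀ i → verts path′ i ∈ x ∷ w ∷ vertices r
    inside′ zero = here refl
    inside′ (suc i) = there (inside i)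

  walk⇒path : ∀ {L U x y} → x ≢ y → Walk L U x y → TemporalPath lab x y
  walk⇒path x≢y w with shortcut w
  ... | stay , _ = contradiction refl x≢y
  ... | step e _ _ r , u = PathWithin.path (simpleWalk⇒path e r u)

  tail : ∀ {x y m} (p : TemporalPath lab x y) → k p ≡ suc m →
         TemporalPath lab (verts p (suc zero)) y
  tail {m = m} p@record { k = .(suc m) } refl = record
    { k = m ; verts = verts p ∘ suc ; times = times p ∘ suc ; start = refl ; end = end p
    ; distinct = FP.suc-injective ∘ distinct p ; edges = edges p ∘ suc
    ; mono = λ i j i≤j → mono p (suc i) (suc j) (s≤s i≤j) }

  path⇒walk : ∀ {x y} (p : TemporalPath lab x y) →
              Walk (times p zero) (times p (fromℕ (k p))) x y
  path⇒walk p = go (k p) p refl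
    where
    go : ∀ m {x y} (p : TemporalPath lab x y) → k p ≡ m →
         Walk (times p zero) (times p (fromℕ (k p))) x y
    go zero p@record { k = .zero ; start = refl ; end = refl } refl =
      step (edges p zero) ≤-refl ≤-refl stay
    go (suc m) p@record { k = .(suc m) ; start = refl } refl =
      step (edges p zero) ≤-refl (mono p zero _ z≤n)
        (weakenˡ (mono p zero (suc zero) z≤n) (go m (tail p refl) refl))

  Reach⇒walk : ∀ {x y} → Reach lab x y → ∃ λ U → Walk 0 U x y
  Reach⇒walk (_ , p) = _ , weakenˡ z≤n (path⇒walk p)

  walk⇒Reach : ∀ {L U x y} → x ≢ y → Walk L U x y → Reach lab x y
  walk⇒Reach x≢y w = x≢y , walk⇒path x≢y w

module Construction {n : ℕ} (G : UTGraph n) where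

  labG : Fin n → Fin n → Maybe ℕ
  labG = UTGraph.lab G

  module WG = TemporalWalks labG

  Connected : ℕ → Fin n → Fin n → Set
  Connected s = Star (λ x y → labG x y ≡ just s)

  Connected-sym : ∀ {s x y} → Connected s x y → Connected s y x
  Connected-sym = reverse (λ {x} {y} e → trans (UTGraph.sym G y x) e)

  ReachIn : ℕ → ℕ → Fin n → Fin n → Set
  ReachIn s zero x y = x ≡ y
  ReachIn s (suc k) x y = ReachIn s k x y ⊎ ∃ λ w → labG x w ≡ just s × ReachIn s k w y

  ReachIn? : ∀ s k x y → Dec (ReachIn s k x y)
  ReachIn? s zero x y = x F.≟ y
  ReachIn? s (suc k) x y =
    ReachIn? s k x y
      ⊎-dec FP.any? (λ w → MP.≡-dec _≟_ (labG x w) (just s) ×-dec ReachIn? s k w y)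

  ReachIn-refl : ∀ {s} k {x} → ReachIn s k x x
  ReachIn-refl zero = refl
  ReachIn-refl (suc k) = inj₁ (ReachIn-refl k)

  ReachIn-mono : ∀ {s k m x y} → k ≤ m → ReachIn s k x y → ReachIn s m x y
  ReachIn-mono {m = m} z≤n refl = ReachIn-refl m
  ReachIn-mono (s≤s k≤m) (inj₁ r) = inj₁ (ReachIn-mono k≤m r)
  ReachIn-mono (s≤s k≤m) (inj₂ (w , e , r)) = inj₂ (w , e , ReachIn-mono k≤m r)

  ReachIn⇒Connected : ∀ {s} k {x y} → ReachIn s k x y → Connected s x y
  ReachIn⇒Connected zero refl = ε
  ReachIn⇒Connected (suc k) (inj₁ r) = ReachIn⇒Connected k r
  ReachIn⇒Connected (suc k) (inj₂ (w , e , r)) = e ◅ ReachIn⇒Connected k r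

  onlyLabel : ℕ → Fin n → Fin n → Maybe ℕ
  onlyLabel s x y with MP.≡-dec _≟_ (labG x y) (just s)
  ... | yes _ = just s
  ... | no _ = nothing

  onlyLabel-intro : ∀ {s x y} → labG x y ≡ just s → onlyLabel s x y ≡ just s
  onlyLabel-intro {s} {x} {y} e with MP.≡-dec _≟_ (labG x y) (just s)
  ... | yes _ = refl
  ... | no ≢s = contradiction e ≢s

  onlyLabel-elim : ∀ {s x y t} → onlyLabel s x y ≡ just t → labG x y ≡ just s
  onlyLabel-elim {s} {x} {y} e with MP.≡-dec _≟_ (labG x y) (just s)
  ... | yes ≡s = ≡s

  module WS (s : ℕ) = TemporalWalks (onlyLabel s)

  Connected⇒walk : ∀ {s x y} → Connected s x y → WS.Walk s s s x y
  Connected⇒walk ε = WS.stay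
  Connected⇒walk (e ◅ c) = WS.step (onlyLabel-intro e) ≤-refl ≤-refl (Connected⇒walk c)

  path⇒ReachIn : ∀ {s x y} (p : TemporalPath (onlyLabel s) x y) →
                 ReachIn s (suc (TemporalPath.k p)) x y
  path⇒ReachIn p = go _ p refl
    where
    open TemporalPath
    go : ∀ {s} m {x y} (p : TemporalPath (onlyLabel s) x y) → k p ≡ m →
         ReachIn s (suc m) x y
    go zero p@record { k = .zero ; start = refl ; end = refl } refl =
      inj₂ (_ , onlyLabel-elim (edges p zero) , refl)
    go {s} (suc m) p@record { k = .(suc m) ; start = refl } refl =
      inj₂ (_ , onlyLabel-elim (edges p zero) , go m (WS.tail s p refl) refl)

  -- A simple path has at most n vertices, so n hops suffice inside a component.
  Connected⇒ReachIn : ∀ {s x y} → Connected s x y → ReachIn s n x y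
  Connected⇒ReachIn {s} {x} {y} c with x F.≟ y
  ... | yes refl = ReachIn-refl n
  ... | no x≢y = ReachIn-mono (≤-trans (n≤1+n _) p-short) (path⇒ReachIn p)
    where
    p : TemporalPath (onlyLabel s) x y
    p = WS.walk⇒path s x≢y (Connected⇒walk c)
    p-short : suc (suc (TemporalPath.k p)) ≤ n
    p-short = FP.injective⇒≤ (TemporalPath.distinct p)

  rootSearch : ∀ s x → Least (ReachIn s n x)
  rootSearch s x = least (ReachIn? s n x) (x , ReachIn-refl n)

  root : ℕ → Fin n → Fin n
  root s x = Least.min (rootSearch s x)

  reach-root : ∀ s x → ReachIn s n x (root s x)
  reach-root s x = Least.holds (rootSearch s x)

  root-cong : ∀ {s x y} → Connected s x y → root s x ≡ root s y
  root-cong {s} {x} {y} c = Least-unique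
    (λ r → Connected⇒ReachIn (Connected-sym c ◅◅ ReachIn⇒Connected n r))
    (λ r → Connected⇒ReachIn (c ◅◅ ReachIn⇒Connected n r))
    (rootSearch s x) (rootSearch s y)

  depthSearch : ∀ s x → Least (λ (k : Fin (suc n)) → ReachIn s (toℕ k) x (root s x))
  depthSearch s x = least (λ k → ReachIn? s (toℕ k) x (root s x))
    (fromℕ n , subst (λ k → ReachIn s k x (root s x)) (sym (FP.toℕ-fromℕ n)) (reach-root s x))

  depth : ℕ → Fin n → ℕ
  depth s x = toℕ (Least.min (depthSearch s x))

  depth≤n : ∀ s x → depth s x ≤ n
  depth≤n s x = FP.toℕ≤pred[n] (Least.min (depthSearch s x))

  reach-root-in-depth : ∀ s x → ReachIn s (depth s x) x (root s x)
  reach-root-in-depth s x = Least.holds (depthSearch s x)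

  depth-minimal : ∀ {s x} k → ReachIn s k x (root s x) → depth s x ≤ k
  depth-minimal {s} {x} k r with k ≤? n
  ... | no k≰n = ≤-trans (depth≤n s x) (<⇒≤ (≰⇒> k≰n))
  ... | yes k≤n = subst (depth s x ≤_) toℕ-k′ (Least.minimal (depthSearch s x) r′)
    where
    toℕ-k′ : toℕ (F.fromℕ< (s≤s k≤n)) ≡ k
    toℕ-k′ = FP.toℕ-fromℕ< (s≤s k≤n)
    r′ : ReachIn s (toℕ (F.fromℕ< (s≤s k≤n))) x (root s x)
    r′ = subst (λ j → ReachIn s j x (root s x)) (sym toℕ-k′) r

  depth-zero : ∀ {s x} → depth s x ≡ 0 → x ≡ root s x
  depth-zero {s} {x} d≡0 =
    subst (λ k → ReachIn s k x (root s x)) d≡0 (reach-root-in-depth s x)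

  parent : ∀ {s x k} → depth s x ≡ suc k → ∃ λ p → labG x p ≡ just s × depth s p ≡ k
  parent {s} {x} {k} d≡1+k
    with subst (λ j → ReachIn s j x (root s x)) d≡1+k (reach-root-in-depth s x)
  ... | inj₁ r = contradiction (subst (_≤ k) d≡1+k (depth-minimal k r)) (n≮n k)
  ... | inj₂ (p , e , r) = p , e , ≤-antisym dp≤k k≤dp
    where
    root-p : root s p ≡ root s x
    root-p = root-cong (Connected-sym (e ◅ ε))
    dp≤k : depth s p ≤ k
    dp≤k = depth-minimal k (subst (ReachIn s k p) (sym root-p) r)
    k≤dp : k ≤ depth s p
    k≤dp = ≤-pred (subst (_≤ suc (depth s p)) d≡1+k
      (depth-minimal (suc (depth s p))
        (inj₂ (p , e , subst (ReachIn s (depth s p) p) root-p (reach-root-in-depth s p)))))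

  -- A time is read in mixed radix (s, v, c): the block of label s consists of B slots,
  -- slot v of it holds the N times  slot s v + c,  one for each arc code c.
  B N : ℕ
  B = suc (suc (n + n))
  N = suc (n * n)

  slot : ℕ → ℕ → ℕ
  slot s v = (s * B + v) * N

  code : Fin n → Fin n → ℕ
  code u v = toℕ (combine u v)

  code<N : ∀ u v → code u v < N
  code<N u v = ≤-trans (FP.toℕ<n (combine u v)) (n≤1+n _)

  slot-monoʳ-≤ : ∀ s {v v′} → v ≤ v′ → slot s v ≤ slot s v′
  slot-monoʳ-≤ s v≤v′ = *-monoˡ-≤ N (+-monoʳ-≤ (s * B) v≤v′)

  slot-monoˡ-≤ : ∀ {s s′} v → s ≤ s′ → slot s v ≤ slot s′ v
  slot-monoˡ-≤ v s≤s′ = *-monoˡ-≤ N (+-monoˡ-≤ v (*-monoˡ-≤ B s≤s′))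

  slot+code< : ∀ s {v v′ c} → v < v′ → c < N → slot s v + c < slot s v′
  slot+code< s v<v′ c<N = m<n⇒m*o+p<n*o (+-monoʳ-< (s * B) v<v′) c<N

  slot-end : ∀ s → slot s B ≡ slot (suc s) 0
  slot-end s = cong (_* N) (trans (+-comm (s * B) B) (sym (+-identityʳ (B + s * B))))

  slot-block : ∀ {s s′} → s < s′ → slot s B ≤ slot s′ 0
  slot-block {s} {s′} s<s′ = subst (_≤ slot s′ 0) (sym (slot-end s)) (slot-monoˡ-≤ 0 s<s′)

  slot-block-reflect : ∀ {s s′} → slot s 0 < slot s′ 0 → s < s′
  slot-block-reflect lt = ≰⇒> (λ s′≤s → <⇒≱ lt (slot-monoˡ-≤ 0 s′≤s))

  label≤slot : ∀ s → s ≤ slot s 0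
  label≤slot s = ≤-trans (m≤m*n s B) (≤-trans (m≤m+n (s * B) 0) (m≤m*n (s * B + 0) N))

  -- Arcs towards the root use the first half of the block, arcs away from it the second.
  arcLabel : ℕ → ℕ → ℕ → ℕ → Maybe ℕ
  arcLabel s du dv c with <-cmp du dv
  ... | tri< _ _ _ = just (slot s (suc (n + du)) + c)
  ... | tri≈ _ _ _ = nothing
  ... | tri> _ _ _ = just (slot s (n ∸ du) + c)

  arcLabel-< : ∀ s {du dv} c → du < dv → arcLabel s du dv c ≡ just (slot s (suc (n + du)) + c)
  arcLabel-< s {du} {dv} c du<dv with <-cmp du dv
  ... | tri< _ _ _ = refl
  ... | tri≈ ¬du<dv _ _ = contradiction du<dv ¬du<dv
  ... | tri> ¬du<dv _ _ = contradiction du<dv ¬du<dv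

  arcLabel-> : ∀ s {du dv} c → dv < du → arcLabel s du dv c ≡ just (slot s (n ∸ du) + c)
  arcLabel-> s {du} {dv} c dv<du with <-cmp du dv
  ... | tri< _ _ ¬dv<du = contradiction dv<du ¬dv<du
  ... | tri≈ _ _ ¬dv<du = contradiction dv<du ¬dv<du
  ... | tri> _ _ _ = refl

  arcLabel-slot : ∀ s {du dv c t} → du ≤ n → arcLabel s du dv c ≡ just t →
                  ∃ λ v → v < B × t ≡ slot s v + c
  arcLabel-slot s {du} {dv} du≤n eq with <-cmp du dv
  arcLabel-slot s {du} du≤n refl | tri< _ _ _ =
    suc (n + du) , s≤s (s≤s (+-monoʳ-≤ n du≤n)) , refl
  arcLabel-slot s {du} du≤n refl | tri> _ _ _ =
    n ∸ du , s≤s (≤-trans (m∸n≤m n du) (≤-trans (m≤m+n n n) (n≤1+n _))) , refl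

  labH : Fin n → Fin n → Maybe ℕ
  labH u v = labG u v >>= λ s → arcLabel s (depth s u) (depth s v) (code u v)

  labH-slot : ∀ {u v t} → labH u v ≡ just t →
              ∃ λ s → labG u v ≡ just s × ∃ λ w → w < B × t ≡ slot s w + code u v
  labH-slot {u} {v} eq with labG u v
  ... | just s = s , refl , arcLabel-slot s (depth≤n s u) eq

  labH-towardsRoot : ∀ {s x p} → labG x p ≡ just s → depth s p < depth s x →
                     labH x p ≡ just (slot s (n ∸ depth s x) + code x p)
  labH-towardsRoot {s} {x} {p} e dp<dx rewrite e = arcLabel-> s (code x p) dp<dx

  labH-awayFromRoot : ∀ {s p a} → labG p a ≡ just s → depth s p < depth s a →
                      labH p a ≡ just (slot s (suc (n + depth s p)) + code p a)
  labH-awayFromRoot {s} {p} {a} e dp<da rewrite e = arcLabel-< s (code p a) dp<da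

  labH-noloop : ∀ u → labH u u ≡ nothing
  labH-noloop u rewrite UTGraph.noloop G u = refl

  H : DTGraph n
  H = record { lab = labH ; noloop = labH-noloop }

  -- Every arc is recovered from its time: its code is the time modulo N.
  labH-injective : ∀ {u v u′ v′ t} → labH u v ≡ just t → labH u′ v′ ≡ just t →
                   u ≡ u′ × v ≡ v′
  labH-injective {u} {v} {u′} {v′} {t} e e′ with labH-slot e | labH-slot e′
  ... | s , _ , w , _ , t≡ | s′ , _ , w′ , _ , t≡′ =
    FP.combine-injective u v u′ v′ (FP.toℕ-injective (begin
      code u v                         ≡⟨ [m*o+p]%o≡p (s * B + w) (code<N u v) ⟨
      (slot s w + code u v) % N        ≡⟨ cong (_% N) (trans (sym t≡) t≡′) ⟩
      (slot s′ w′ + code u′ v′) % N    ≡⟨ [m*o+p]%o≡p (s′ * B + w′) (code<N u′ v′) ⟩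
      code u′ v′                       ∎))
    where open ≡-Reasoning

  proper : Proper H
  proper u v u′ v′ t e e′ _ = labH-injective e e′

  module WH = TemporalWalks labH

  root-parent : ∀ {s x p} → labG x p ≡ just s → root s p ≡ root s x
  root-parent e = root-cong (Connected-sym (e ◅ ε))

  climb : ∀ s k x → depth s x ≡ k →
          WH.Walk (slot s (n ∸ depth s x)) (slot s n) x (root s x)
  climb s zero x d≡0 = subst (WH.Walk _ _ x) (depth-zero d≡0) WH.stay
  climb s (suc k) x d≡1+k with parent d≡1+k
  ... | p , e , dp≡k =
    WH.step (labH-towardsRoot e dp<dx) (m≤m+n _ _) (<⇒≤ (slot+code< s n∸dx<n (code<N x p)))
      (WH.weakenˡ (<⇒≤ (slot+code< s n∸dx<n∸dp (code<N x p)))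
        (subst (WH.Walk _ _ p) (root-parent e) (climb s k p dp≡k)))
    where
    dp<dx : depth s p < depth s x
    dp<dx = subst₂ _<_ (sym dp≡k) (sym d≡1+k) (n<1+n k)
    n∸dx<n : n ∸ depth s x < n
    n∸dx<n = ∸-monoʳ-< (≤-<-trans z≤n dp<dx) (depth≤n s x)
    n∸dx<n∸dp : n ∸ depth s x < n ∸ depth s p
    n∸dx<n∸dp = ∸-monoʳ-< dp<dx (depth≤n s x)

  descend : ∀ s k a → depth s a ≡ k →
            WH.Walk (slot s n) (slot s (suc (n + depth s a))) (root s a) a
  descend s zero a d≡0 =
    subst (λ r → WH.Walk _ (slot s (suc (n + depth s a))) r a) (depth-zero d≡0) WH.stay
  descend s (suc k) a d≡1+k with parent d≡1+k
  ... | p , e , dp≡k =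
    WH.append (slot-monoʳ-≤ s (≤-trans (m≤m+n n (depth s p)) (n≤1+n _)))
      (<⇒≤ (≤-<-trans (m≤m+n _ _) last<))
      (subst (λ r → WH.Walk _ _ r p) (root-parent e) (descend s k p dp≡k))
      (WH.step (labH-awayFromRoot (trans (UTGraph.sym G p a) e) dp<da)
        (m≤m+n _ _) (<⇒≤ last<) WH.stay)
    where
    dp<da : depth s p < depth s a
    dp<da = subst₂ _<_ (sym dp≡k) (sym d≡1+k) (n<1+n k)
    last< : slot s (suc (n + depth s p)) + code p a < slot s (suc (n + depth s a))
    last< = slot+code< s (s≤s (+-monoʳ-< n dp<da)) (code<N p a)

  component : ∀ {s x a} → Connected s x a → WH.Walk (slot s 0) (slot s B) x a
  component {s} {x} {a} c =
    WH.weakenˡ (slot-monoʳ-≤ s z≤n) (WH.weakenʳ (slot-monoʳ-≤ s da<B)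
      (WH.append (slot-monoʳ-≤ s (m∸n≤m n (depth s x)))
        (slot-monoʳ-≤ s (≤-trans (m≤m+n n _) (n≤1+n _)))
        (climb s _ x refl)
        (subst (λ r → WH.Walk (slot s n) _ r a) (sym (root-cong c)) (descend s _ a refl))))
    where
    da<B : suc (n + depth s a) ≤ B
    da<B = ≤-trans (s≤s (+-monoʳ-≤ n (depth≤n s a))) (n≤1+n _)

  -- The edges of label s met so far are kept as  Connected s x a  and crossed in a single
  -- block of H once the walk moves on to a larger label.
  G⇒H : ∀ {s U a y} → WG.Walk s U a y → ∀ {x} → Connected s x a →
        ∃ λ U′ → WH.Walk (slot s 0) U′ x y
  G⇒H {s} WG.stay c = slot s B , component c
  G⇒H {s} (WG.step e s≤s′ _ w) c with m≤n⇒m<n∨m≡n s≤s′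
  ... | inj₂ refl = G⇒H w (c ◅◅ (e ◅ ε))
  ... | inj₁ s<s′ with G⇒H w (e ◅ ε)
  ...   | U′ , w′ = U′ ⊔ slot s B ,
          WH.append (slot-monoʳ-≤ s z≤n) (m≤n⊔m U′ _) (component c)
            (WH.weakenˡ (slot-block s<s′) (WH.weakenʳ (m≤m⊔n U′ _) w′))

  H⇒G : ∀ {L U x y} → WH.Walk L U x y → ∀ {t} → slot t 0 ≤ L → WG.Walk t U x y
  H⇒G WH.stay _ = WG.stay
  H⇒G (WH.step {x = x} {w = w} {s = ℓ} e L≤ℓ ℓ≤U r) {t} t≤L with labH-slot e
  ... | s , eG , v , v<B , ℓ≡ =
    WG.step eG t≤s (≤-trans (label≤slot s) (≤-trans s≤ℓ ℓ≤U)) (H⇒G r s≤ℓ)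
    where
    s≤ℓ : slot s 0 ≤ ℓ
    s≤ℓ = subst (slot s 0 ≤_) (sym ℓ≡) (≤-trans (slot-monoʳ-≤ s z≤n) (m≤m+n _ _))
    ℓ<next : ℓ < slot (suc s) 0
    ℓ<next = subst₂ _<_ (sym ℓ≡) (slot-end s) (slot+code< s v<B (code<N x w))
    t≤s : t ≤ s
    t≤s = ≤-pred (slot-block-reflect (≤-<-trans (≤-trans t≤L L≤ℓ) ℓ<next))

  sameReach : SameReach G H
  sameReach u v = mk⇔
    (λ r@(u≢v , _) → WH.walk⇒Reach u≢v (proj₂ (G⇒H (proj₂ (WG.Reach⇒walk r)) ε)))
    (λ r@(u≢v , _) → WG.walk⇒Reach u≢v (H⇒G (proj₂ (WH.Reach⇒walk r)) {0} z≤n))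

lemma25 : ∀ (n : ℕ) (G : UTGraph n) → Σ (DTGraph n) (λ H → Proper H × SameReach G H)
lemma25 n G = H , proper , sameReach
  where open Construction G
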